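{- Let $n\ge1$ and let $f$ be the $n$-ary operation on $\mathbb{Z}_8$ given by $f(\mathbf{x})=x_1x_2\cdots x_n\sum_{\alpha\in I_n}b_\alpha\mathbf{x}^\alpha$ with all coefficients $b_\alpha\in\mathbb{Z}_8$ even. Then $f$ preserves the relation $Z$.
   Context: $I_n$ is the set of all $n$-tuples $\alpha\in\{0,1,2\}^n$ with at most two nonzero components, and $\mathbf{x}^\alpha=x_1^{\alpha_1}\cdots x_n^{\alpha_n}$. Let $P_4$ be the power set of $\{1,2,3,4\}$; tuples in $\mathbb{Z}_8^{P_4}$ are written $\mathbf{x}=(x_A\mid A\in P_4)$. For $A\in P_4$ let $\mathbf{g}^A$ have $g^A_B=1$ if $A\subseteq B$ and $0$ otherwise. Every $\mathbf{x}$ is uniquely $\mathbf{x}=\sum_A a_A\mathbf{g}^A$ with $a_A\in\mathbb{Z}_8$ (namely $a_A=(-1)^{|A|}\sum_{B\subseteq A}(-1)^{|B|}x_B$). $Z$ is the set of $\mathbf{x}\in\mathbb{Z}_8^{P_4}$ whose coordinates satisfy: (Z1) $a_{\{2\}}\equiv 2a_{\{1\}}$ and $a_{\{4\}}\equiv 2a_{\{3\}}\pmod 4$; (Z2) $a_A\equiv0\pmod 2$ whenever $|A|\ge2$; (Z3) $a_A\equiv0\pmod4$ whenever $|A|\ge2$ and $A\cap\{2,4\}\ne\emptyset$; (Z4) $a_A=0$ whenever $\{2,4\}\subseteq A$. An operation preserves $Z$ if applying it componentwise to tuples of $Z$ yields a tuple of $Z$. -}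

module Defs where

open import Data.Nat using (ℕ; zero; suc; _+_; _*_; _∸_; _≥_; _%_)
open import Data.Nat.DivMod using (_mod_)
open import Data.Nat.Divisibility using (_∣_)
open import Data.Fin using (Fin; toℕ) renaming (zero to fz; suc to fs)
open import Data.Fin.Subset using (Subset; _∩_; _∪_; ⁅_⁆; ∣_∣; Nonempty; _⊆_; outside; inside)
open import Data.Fin.Subset.Properties using (_⊆?_)
open import Data.Bool using (Bool; true; false; if_then_else_)
open import Data.Vec using (Vec; []; _∷_; zipWith; foldr; map)
open import Data.List using (List; []; _∷_; _++_; filter) renaming (map to lmap; foldr to lfoldr)
open import Data.Vec.Relation.Unary.All using (All)
open import Data.Nat using (_≤_; _≤?_)
open import Relation.Nullary using (Dec; yes; no)
open import Relation.Binary.PropositionalEquality using (_≡_)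

ℤ₈ : Set
ℤ₈ = Fin 8

infixl 6 _+₈_
infixl 7 _*₈_

_+₈_ : ℤ₈ → ℤ₈ → ℤ₈
x +₈ y = (toℕ x + toℕ y) mod 8

_*₈_ : ℤ₈ → ℤ₈ → ℤ₈
x *₈ y = (toℕ x * toℕ y) mod 8

-₈_ : ℤ₈ → ℤ₈
-₈ x = (8 ∸ toℕ x) mod 8

0₈ 1₈ 2₈ : ℤ₈
0₈ = 0 mod 8
1₈ = 1 mod 8
2₈ = 2 mod 8

_^₈_ : ℤ₈ → ℕ → ℤ₈
x ^₈ zero = 1₈
x ^₈ suc k = x *₈ (x ^₈ k)

sum₈ : List ℤ₈ → ℤ₈
sum₈ = lfoldr _+₈_ 0₈

-- congruence modulo m of elements of ℤ₈ (well defined for m ∣ 8)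
_≡₈_[mod_] : ℤ₈ → ℤ₈ → ℕ → Set
x ≡₈ y [mod 0 ] = x ≡ y
x ≡₈ y [mod suc m ] = toℕ x % suc m ≡ toℕ y % suc m

Even₈ : ℤ₈ → Set
Even₈ x = 2 ∣ toℕ x

-- P₄ = power set of {1,2,3,4}; element i of {1,2,3,4} is (i-1) : Fin 4

P₄ : Set
P₄ = Subset 4

allSubsets : (n : ℕ) → List (Subset n)
allSubsets zero = [] ∷ []
allSubsets (suc n) =
  lmap (outside ∷_) (allSubsets n) ++ lmap (inside ∷_) (allSubsets n)

Tuple : Set
Tuple = P₄ → ℤ₈

signPow : ℕ → ℤ₈ → ℤ₈
signPow zero y = y
signPow (suc k) y = -₈ (signPow k y)

coeff : Tuple → P₄ → ℤ₈
coeff x A = signPow ∣ A ∣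
  (sum₈ (lmap (λ B → signPow ∣ B ∣ (x B))
              (filter (λ B → B ⊆? A) (allSubsets 4))))

e1 e2 e3 e4 : Fin 4
e1 = fz
e2 = fs fz
e3 = fs (fs fz)
e4 = fs (fs (fs fz))

S24 : P₄
S24 = ⁅ e2 ⁆ ∪ ⁅ e4 ⁆

record InZ (x : Tuple) : Set where
  field
    Z1a : coeff x ⁅ e2 ⁆ ≡₈ 2₈ *₈ coeff x ⁅ e1 ⁆ [mod 4 ]
    Z1b : coeff x ⁅ e4 ⁆ ≡₈ 2₈ *₈ coeff x ⁅ e3 ⁆ [mod 4 ]
    Z2  : (A : P₄) → ∣ A ∣ ≥ 2 → 2 ∣ toℕ (coeff x A)
    Z3  : (A : P₄) → ∣ A ∣ ≥ 2 → Nonempty (A ∩ S24) → 4 ∣ toℕ (coeff x A)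
    Z4  : (A : P₄) → S24 ⊆ A → coeff x A ≡ 0₈

allExps : (n : ℕ) → List (Vec (Fin 3) n)
allExps zero = [] ∷ []
allExps (suc n) =
  lmap (fz ∷_) (allExps n) ++ (lmap (fs fz ∷_) (allExps n) ++ lmap (fs (fs fz) ∷_) (allExps n))

nonzeros : {n : ℕ} → Vec (Fin 3) n → ℕ
nonzeros [] = 0
nonzeros (fz ∷ α) = nonzeros α
nonzeros (fs _ ∷ α) = suc (nonzeros α)

InI : {n : ℕ} → Vec (Fin 3) n → Set
InI α = nonzeros α ≤ 2

InI? : {n : ℕ} → (α : Vec (Fin 3) n) → Dec (InI α)
InI? α = nonzeros α ≤? 2

I : (n : ℕ) → List (Vec (Fin 3) n)
I n = filter InI? (allExps n)

monomial : {n : ℕ} → Vec ℤ₈ n → Vec (Fin 3) n → ℤ₈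
monomial x α = foldr _ _*₈_ 1₈ (zipWith (λ xi ai → xi ^₈ toℕ ai) x α)

prod₈ : {n : ℕ} → Vec ℤ₈ n → ℤ₈
prod₈ = foldr _ _*₈_ 1₈

fOp : (n : ℕ) → (Vec (Fin 3) n → ℤ₈) → Vec ℤ₈ n → ℤ₈
fOp n b x = prod₈ x *₈ sum₈ (lmap (λ α → b α *₈ monomial x α) (I n))

Preserves : (n : ℕ) → (Vec ℤ₈ n → ℤ₈) → Set
Preserves n g = (ts : Vec Tuple n) → All InZ ts → InZ (λ A → g (map (λ t → t A) ts))

-- For a tuple x write Δᵢx for its difference along coordinate i: (Δᵢx)_B = x_{B∪{i}} − x_{B∖{i}}.
-- The coefficients a_A form the Möbius transform of x. A power of 2 divides all values of a tuple
-- iff it divides all its Möbius coefficients, and the coefficients of Δᵢx are those of x at the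
-- sets containing i (and 0 at the others). Call x filtered of level k if 2ᵏ divides its values,
-- 2ᵏ⁺¹ divides Δ₂x and Δ₄x, and 2ᵏ⁺² divides Δ₂Δ₄x. Then (Z1)-(Z4) put every tuple of Z at level 0,
-- and every tuple of level 1 lies in Z (there 2³ = 0 in ℤ₈ forces Δ₂Δ₄x = 0, which gives (Z4)).
-- By the Leibniz rule for Δ, levels add under pointwise products, and sums keep the level. For
-- arguments in Z the product x₁⋯xₙ and the monomials x^α are therefore of level 0, each term
-- b_α x^α with b_α even is of level 1, and so is f: it maps Z into Z.

module Submission where

open import Defs
open import Algebra.Bundles using (CommutativeRing; Ring)
open import Algebra.Structures using (IsCommutativeRing)
open import Data.Bool using (true; false)
open import Data.Fin using (Fin; toℕ) renaming (zero to fz; suc to fs)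
open import Data.Fin.Properties using (all?; any?; _≟_)
open import Data.Fin.Subset using (Subset; inside; outside; _∩_; Nonempty; _⊆_; ∣_∣; ⁅_⁆)
  renaming (_∈_ to _∈ˢ_; ⊥ to ∅)
open import Data.Fin.Subset.Properties using (_⊆?_; x∈p∩q⁻)
open import Data.List as List using (List; []; _∷_; _++_; filter)
open import Data.List.Properties using (filter-++; map-++; map-∘; map-cong; ++-identityʳ)
open import Data.List.Membership.Propositional using (_∈_)
open import Data.List.Relation.Unary.Any using (here; there)
open import Data.Nat as ℕ using (ℕ; zero; suc; _≥_; _%_; s≤s; z≤n)
open import Data.Nat.Divisibility using (divides)
  renaming (_∣_ to _∣ℕ_; _∣?_ to _∣ℕ?_; ∣-trans to ∣ℕ-trans)
open import Data.Nat.Properties using (+-suc) renaming (_≟_ to _≟ℕ_)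
open import Data.Product using (_,_)
open import Data.Sum using (_⊎_; inj₁; inj₂)
open import Data.Vec as Vec using (Vec; []; _∷_; _[_]≔_; here; there)
open import Data.Vec.Properties using ([]≔-idempotent)
open import Data.Vec.Relation.Unary.All using (All; []; _∷_)
open import Function using (_∘_)
open import Relation.Binary.PropositionalEquality
open import Relation.Nullary using (Dec; does)
open import Relation.Nullary.Decidable using (toWitness; dec⇒maybe; _→-dec_)
import Relation.Nullary.Decidable as Dec
open import Tactic.RingSolver using (solve-∀)
open import Tactic.RingSolver.Core.AlmostCommutativeRing
  using (AlmostCommutativeRing; fromCommutativeRing)

ℤ₈-isCommutativeRing : IsCommutativeRing _≡_ _+₈_ _*₈_ -₈_ 0₈ 1₈
ℤ₈-isCommutativeRing = record
  { isRing = record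
    { +-isAbelianGroup = record
      { isGroup = record
        { isMonoid = record
          { isSemigroup = record
            { isMagma = record { isEquivalence = isEquivalence ; ∙-cong = cong₂ _+₈_ }
            ; assoc   = toWitness {a? = all? λ x → all? λ y → all? λ z →
                                          (x +₈ y) +₈ z ≟ x +₈ (y +₈ z)} _
            }
          ; identity = toWitness {a? = all? λ x → 0₈ +₈ x ≟ x} _
                     , toWitness {a? = all? λ x → x +₈ 0₈ ≟ x} _
          }
        ; inverse = toWitness {a? = all? λ x → -₈ x +₈ x ≟ 0₈} _
                  , toWitness {a? = all? λ x → x +₈ -₈ x ≟ 0₈} _
        ; ⁻¹-cong = cong -₈_
        }
      ; comm = toWitness {a? = all? λ x → all? λ y → x +₈ y ≟ y +₈ x} _
      }
    ; *-cong     = cong₂ _*₈_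
    ; *-assoc    = toWitness {a? = all? λ x → all? λ y → all? λ z →
                                     (x *₈ y) *₈ z ≟ x *₈ (y *₈ z)} _
    ; *-identity = toWitness {a? = all? λ x → 1₈ *₈ x ≟ x} _
                 , toWitness {a? = all? λ x → x *₈ 1₈ ≟ x} _
    ; distrib    = toWitness {a? = all? λ x → all? λ y → all? λ z →
                                     x *₈ (y +₈ z) ≟ x *₈ y +₈ x *₈ z} _
                 , toWitness {a? = all? λ x → all? λ y → all? λ z →
                                     (y +₈ z) *₈ x ≟ y *₈ x +₈ z *₈ x} _
    }
  ; *-comm = toWitness {a? = all? λ x → all? λ y → x *₈ y ≟ y *₈ x} _
  }

ℤ₈-commutativeRing : CommutativeRing _ _
ℤ₈-commutativeRing = record { isCommutativeRing = ℤ₈-isCommutativeRing }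

ℤ₈-almostCommutativeRing : AlmostCommutativeRing _ _
ℤ₈-almostCommutativeRing = fromCommutativeRing ℤ₈-commutativeRing (λ x → dec⇒maybe (0₈ ≟ x))

open CommutativeRing ℤ₈-commutativeRing
  using ( +-identityˡ; +-identityʳ; +-assoc; *-assoc; *-identityˡ; -‿inverseʳ
        ; ring; *-commutativeSemigroup; semiring)

infixl 6 _-₈_
_-₈_ : ℤ₈ → ℤ₈ → ℤ₈
x -₈ y = x +₈ -₈ y

module RingDivisibility {c ℓ} (R : Ring c ℓ) where
  open Ring R using (_+_; -_; *-rawMagma; distribʳ; +-cong; -‿cong)
    renaming (trans to ≈-trans; sym to ≈-sym)
  open import Algebra.Definitions.RawMagma *-rawMagma using (_∣_; _,_)
  open import Algebra.Properties.Ring R using (-‿distribˡ-*)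

  x∣y∧x∣z⇒x∣y+z : ∀ {x y z} → x ∣ y → x ∣ z → x ∣ y + z
  x∣y∧x∣z⇒x∣y+z {x} (q , qx≈y) (r , rx≈z) = q + r , ≈-trans (distribʳ x q r) (+-cong qx≈y rx≈z)

  x∣y⇒x∣-y : ∀ {x y} → x ∣ y → x ∣ - y
  x∣y⇒x∣-y {x} (q , qx≈y) = - q , ≈-trans (≈-sym (-‿distribˡ-* q x)) (-‿cong qx≈y)

open RingDivisibility ring
open import Algebra.Properties.CommutativeSemigroup.Divisibility *-commutativeSemigroup
  using (_∣_; _,_; ∙-cong-∣; ∣ʳ-respʳ-≈)
open import Algebra.Properties.Semiring.Divisibility semiring using (_∣0; 0∣x⇒x≈0; ε∣ʳ_)

x≡0⇒y∣x : ∀ {x y} → x ≡ 0₈ → y ∣ x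
x≡0⇒y∣x {y = y} x≡0 = ∣ʳ-respʳ-≈ (sym x≡0) (y ∣0)

_∣?_ : ∀ m a → Dec (m ∣ a)
m ∣? a = Dec.map′ (λ (q , qm≡a) → q , qm≡a) (λ (q , qm≡a) → q , qm≡a) (any? λ q → q *₈ m ≟ a)

sum₈-++ : ∀ xs ys → sum₈ (xs ++ ys) ≡ sum₈ xs +₈ sum₈ ys
sum₈-++ []       ys = sym (+-identityˡ (sum₈ ys))
sum₈-++ (x ∷ xs) ys = trans (cong (x +₈_) (sum₈-++ xs ys)) (sym (+-assoc x (sum₈ xs) (sum₈ ys)))

sum₈-map-neg : ∀ {A : Set} (f : A → ℤ₈) xs →
  sum₈ (List.map (λ a → -₈ f a) xs) ≡ -₈ sum₈ (List.map f xs)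
sum₈-map-neg f []       = refl
sum₈-map-neg f (a ∷ xs) = trans (cong (-₈ f a +₈_) (sum₈-map-neg f xs)) (neg-+ (f a) _)
  where
  neg-+ : ∀ x y → -₈ x +₈ -₈ y ≡ -₈ (x +₈ y)
  neg-+ = solve-∀ ℤ₈-almostCommutativeRing

sum₈-map-sub : ∀ {A : Set} (f g : A → ℤ₈) xs →
  sum₈ (List.map (λ a → f a -₈ g a) xs) ≡ sum₈ (List.map f xs) -₈ sum₈ (List.map g xs)
sum₈-map-sub f g []       = refl
sum₈-map-sub f g (a ∷ xs) =
  trans (cong (f a -₈ g a +₈_) (sum₈-map-sub f g xs)) (interchange (f a) (g a) _ _)
  where
  interchange : ∀ x y u v → (x -₈ y) +₈ (u -₈ v) ≡ (x +₈ u) -₈ (y +₈ v)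
  interchange = solve-∀ ℤ₈-almostCommutativeRing

signPow-sub : ∀ k x y → signPow k (x -₈ y) ≡ signPow k x -₈ signPow k y
signPow-sub zero    x y = refl
signPow-sub (suc k) x y =
  trans (cong -₈_ (signPow-sub k x y)) (neg-sub (signPow k x) (signPow k y))
  where
  neg-sub : ∀ u v → -₈ (u -₈ v) ≡ -₈ u -₈ -₈ v
  neg-sub = solve-∀ ℤ₈-almostCommutativeRing

signPow-∣ : ∀ {m y} k → m ∣ y → m ∣ signPow k y
signPow-∣ zero    m∣y = m∣y
signPow-∣ (suc k) m∣y = x∣y⇒x∣-y (signPow-∣ k m∣y)

sum₈-map-∣ : ∀ {m} {A : Set} {f : A → ℤ₈} → (∀ a → m ∣ f a) → ∀ xs → m ∣ sum₈ (List.map f xs)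
sum₈-map-∣ {m} m∣f []       = m ∣0
sum₈-map-∣ {m} m∣f (a ∷ xs) = x∣y∧x∣z⇒x∣y+z (m∣f a) (sum₈-map-∣ m∣f xs)

-- The Möbius transform and differences on subsets of an n-set

subsetsOf : ∀ {n} → Subset n → List (Subset n)
subsetsOf {n} A = filter (_⊆? A) (allSubsets n)

sumBelow : ∀ {n} → Subset n → (Subset n → ℤ₈) → ℤ₈
sumBelow A f = sum₈ (List.map f (subsetsOf A))

-- coeff is möbius at n = 4 by definition, so the lemmas below apply to it directly.
möbius : ∀ {n} → (Subset n → ℤ₈) → Subset n → ℤ₈
möbius x A = signPow ∣ A ∣ (sumBelow A (λ B → signPow ∣ B ∣ (x B)))

module _ {n} (A : Subset n) where

  filter-⊆?∷-map-outside∷ : ∀ s T →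
    filter (_⊆? (s ∷ A)) (List.map (outside ∷_) T) ≡ List.map (outside ∷_) (filter (_⊆? A) T)
  filter-⊆?∷-map-outside∷ s []      = refl
  filter-⊆?∷-map-outside∷ s (B ∷ T) with does (B ⊆? A)
  ... | true  = cong ((outside ∷ B) ∷_) (filter-⊆?∷-map-outside∷ s T)
  ... | false = filter-⊆?∷-map-outside∷ s T

  filter-⊆?inside∷-map-inside∷ : ∀ T →
    filter (_⊆? (inside ∷ A)) (List.map (inside ∷_) T) ≡ List.map (inside ∷_) (filter (_⊆? A) T)
  filter-⊆?inside∷-map-inside∷ []      = refl
  filter-⊆?inside∷-map-inside∷ (B ∷ T) with does (B ⊆? A)
  ... | true  = cong ((inside ∷ B) ∷_) (filter-⊆?inside∷-map-inside∷ T)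
  ... | false = filter-⊆?inside∷-map-inside∷ T

  filter-⊆?outside∷-map-inside∷ : ∀ T → filter (_⊆? (outside ∷ A)) (List.map (inside ∷_) T) ≡ []
  filter-⊆?outside∷-map-inside∷ []      = refl
  filter-⊆?outside∷-map-inside∷ (B ∷ T) = filter-⊆?outside∷-map-inside∷ T

  subsetsOf-outside∷ : subsetsOf (outside ∷ A) ≡ List.map (outside ∷_) (subsetsOf A)
  subsetsOf-outside∷ = begin
    filter (_⊆? (outside ∷ A)) (outside∷S ++ inside∷S)
      ≡⟨ filter-++ (_⊆? (outside ∷ A)) outside∷S inside∷S ⟩
    filter (_⊆? (outside ∷ A)) outside∷S ++ filter (_⊆? (outside ∷ A)) inside∷S
      ≡⟨ cong₂ _++_ (filter-⊆?∷-map-outside∷ outside S) (filter-⊆?outside∷-map-inside∷ S) ⟩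
    List.map (outside ∷_) (subsetsOf A) ++ []
      ≡⟨ ++-identityʳ _ ⟩
    List.map (outside ∷_) (subsetsOf A) ∎
    where
    open ≡-Reasoning
    S = allSubsets n
    outside∷S = List.map (outside ∷_) S
    inside∷S  = List.map (inside ∷_) S

  subsetsOf-inside∷ :
    subsetsOf (inside ∷ A) ≡ List.map (outside ∷_) (subsetsOf A) ++ List.map (inside ∷_) (subsetsOf A)
  subsetsOf-inside∷ =
    trans (filter-++ (_⊆? (inside ∷ A)) (List.map (outside ∷_) S) (List.map (inside ∷_) S))
          (cong₂ _++_ (filter-⊆?∷-map-outside∷ inside S) (filter-⊆?inside∷-map-inside∷ S))
    where S = allSubsets n

  sumBelow-outside∷ : ∀ f → sumBelow (outside ∷ A) f ≡ sumBelow A (f ∘ (outside ∷_))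
  sumBelow-outside∷ f =
    trans (cong (sum₈ ∘ List.map f) subsetsOf-outside∷) (cong sum₈ (sym (map-∘ (subsetsOf A))))

  sumBelow-inside∷ : ∀ f →
    sumBelow (inside ∷ A) f ≡ sumBelow A (f ∘ (outside ∷_)) +₈ sumBelow A (f ∘ (inside ∷_))
  sumBelow-inside∷ f = begin
    sum₈ (List.map f (subsetsOf (inside ∷ A)))
      ≡⟨ cong (sum₈ ∘ List.map f) subsetsOf-inside∷ ⟩
    sum₈ (List.map f (outside∷F ++ inside∷F))
      ≡⟨ cong sum₈ (map-++ f outside∷F inside∷F) ⟩
    sum₈ (List.map f outside∷F ++ List.map f inside∷F)
      ≡⟨ sum₈-++ (List.map f outside∷F) (List.map f inside∷F) ⟩
    sum₈ (List.map f outside∷F) +₈ sum₈ (List.map f inside∷F)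
      ≡⟨ cong₂ _+₈_ (cong sum₈ (sym (map-∘ F))) (cong sum₈ (sym (map-∘ F))) ⟩
    sumBelow A (f ∘ (outside ∷_)) +₈ sumBelow A (f ∘ (inside ∷_)) ∎
    where
    open ≡-Reasoning
    F = subsetsOf A
    outside∷F = List.map (outside ∷_) F
    inside∷F  = List.map (inside ∷_) F

möbius-cong : ∀ {n} {x y : Subset n → ℤ₈} → (∀ B → x B ≡ y B) → ∀ A → möbius x A ≡ möbius y A
möbius-cong x≗y A =
  cong (signPow ∣ A ∣ ∘ sum₈) (map-cong (λ B → cong (signPow ∣ B ∣) (x≗y B)) (subsetsOf A))

möbius-outside∷ : ∀ {n} (x : Subset (suc n) → ℤ₈) A →
  möbius x (outside ∷ A) ≡ möbius (x ∘ (outside ∷_)) A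
möbius-outside∷ x A = cong (signPow ∣ A ∣) (sumBelow-outside∷ A _)

möbius-inside∷ : ∀ {n} (x : Subset (suc n) → ℤ₈) A →
  möbius x (inside ∷ A) ≡ möbius (λ B → x (inside ∷ B) -₈ x (outside ∷ B)) A
möbius-inside∷ x A = begin
  -₈ σ (sumBelow (inside ∷ A) (λ B → signPow ∣ B ∣ (x B)))
    ≡⟨ cong (-₈_ ∘ σ) (sumBelow-inside∷ A _) ⟩
  -₈ σ (P +₈ sumBelow A (λ B → -₈ signPow ∣ B ∣ (x (inside ∷ B))))
    ≡⟨ cong (λ t → -₈ σ (P +₈ t))
            (sum₈-map-neg (λ B → signPow ∣ B ∣ (x (inside ∷ B))) (subsetsOf A)) ⟩
  -₈ σ (P -₈ Q)
    ≡⟨ cong -₈_ (signPow-sub ∣ A ∣ P Q) ⟩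
  -₈ (σ P -₈ σ Q)
    ≡⟨ neg-sub (σ P) (σ Q) ⟩
  σ Q -₈ σ P
    ≡⟨ sym (signPow-sub ∣ A ∣ Q P) ⟩
  σ (Q -₈ P)
    ≡⟨ cong σ (sym (sum₈-map-sub (λ B → signPow ∣ B ∣ (x (inside ∷ B)))
                                   (λ B → signPow ∣ B ∣ (x (outside ∷ B))) (subsetsOf A))) ⟩
  σ (sumBelow A (λ B → signPow (∣ B ∣) (x (inside ∷ B)) -₈ signPow (∣ B ∣) (x (outside ∷ B))))
    ≡⟨ cong (σ ∘ sum₈) (map-cong (λ B → sym (signPow-sub ∣ B ∣ (x (inside ∷ B)) (x (outside ∷ B))))
                                 (subsetsOf A)) ⟩
  möbius (λ B → x (inside ∷ B) -₈ x (outside ∷ B)) A ∎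
  where
  open ≡-Reasoning
  σ = signPow ∣ A ∣
  P = sumBelow A (λ B → signPow ∣ B ∣ (x (outside ∷ B)))
  Q = sumBelow A (λ B → signPow ∣ B ∣ (x (inside ∷ B)))
  neg-sub : ∀ u v → -₈ (u -₈ v) ≡ v -₈ u
  neg-sub = solve-∀ ℤ₈-almostCommutativeRing

möbius-preserves-∣ : ∀ {n m} {x : Subset n → ℤ₈} → (∀ B → m ∣ x B) → ∀ A → m ∣ möbius x A
möbius-preserves-∣ m∣x A =
  signPow-∣ ∣ A ∣ (sum₈-map-∣ (λ B → signPow-∣ ∣ B ∣ (m∣x B)) (subsetsOf A))

möbius-reflects-∣ : ∀ {n m} (x : Subset n → ℤ₈) → (∀ A → m ∣ möbius x A) → ∀ B → m ∣ x B
möbius-reflects-∣ {zero}      x m∣μx []      = ∣ʳ-respʳ-≈ (+-identityʳ (x [])) (m∣μx [])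
möbius-reflects-∣ {suc n} {m} x m∣μx = at
  where
  at-outside∷ : ∀ B → m ∣ x (outside ∷ B)
  at-outside∷ = möbius-reflects-∣ (x ∘ (outside ∷_))
    (λ A → subst (m ∣_) (möbius-outside∷ x A) (m∣μx (outside ∷ A)))
  at-difference : ∀ B → m ∣ x (inside ∷ B) -₈ x (outside ∷ B)
  at-difference = möbius-reflects-∣ (λ B → x (inside ∷ B) -₈ x (outside ∷ B))
    (λ A → subst (m ∣_) (möbius-inside∷ x A) (m∣μx (inside ∷ A)))
  sub-+-cancel : ∀ u v → (u -₈ v) +₈ v ≡ u
  sub-+-cancel = solve-∀ ℤ₈-almostCommutativeRing
  at : ∀ B → m ∣ x B
  at (outside ∷ B) = at-outside∷ B
  at (inside ∷ B)  =
    subst (m ∣_) (sub-+-cancel _ _) (x∣y∧x∣z⇒x∣y+z (at-difference B) (at-outside∷ B))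

Δ : ∀ {n} → Fin n → (Subset n → ℤ₈) → Subset n → ℤ₈
Δ i x B = x (B [ i ]≔ inside) -₈ x (B [ i ]≔ outside)

Δ-cong : ∀ {n} i {x y : Subset n → ℤ₈} → (∀ B → x B ≡ y B) → ∀ B → Δ i x B ≡ Δ i y B
Δ-cong i x≗y B = cong₂ _-₈_ (x≗y _) (x≗y _)

Δ-[]≔ : ∀ {n} i (x : Subset n → ℤ₈) B s → Δ i x (B [ i ]≔ s) ≡ Δ i x B
Δ-[]≔ i x B s = cong₂ _-₈_ (cong x ([]≔-idempotent B i)) (cong x ([]≔-idempotent B i))

Δ-Δ≡0 : ∀ {n} i (x : Subset n → ℤ₈) B → Δ i (Δ i x) B ≡ 0₈
Δ-Δ≡0 i x B = trans (cong₂ _-₈_ (Δ-[]≔ i x B inside) (Δ-[]≔ i x B outside)) (-‿inverseʳ (Δ i x B))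

möbius-Δ : ∀ {n} i (x : Subset n → ℤ₈) A →
  möbius x (A [ i ]≔ inside) ≡ möbius (Δ i x) (A [ i ]≔ outside)
möbius-Δ fz x (_ ∷ A) = trans (möbius-inside∷ x A) (sym (möbius-outside∷ (Δ fz x) A))
möbius-Δ (fs i) x (outside ∷ A) = begin
  möbius x (outside ∷ A [ i ]≔ inside)
    ≡⟨ möbius-outside∷ x (A [ i ]≔ inside) ⟩
  möbius (x ∘ (outside ∷_)) (A [ i ]≔ inside)
    ≡⟨ möbius-Δ i (x ∘ (outside ∷_)) A ⟩
  möbius (Δ i (x ∘ (outside ∷_))) (A [ i ]≔ outside)
    ≡⟨ sym (möbius-outside∷ (Δ (fs i) x) (A [ i ]≔ outside)) ⟩
  möbius (Δ (fs i) x) (outside ∷ A [ i ]≔ outside) ∎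
  where open ≡-Reasoning
möbius-Δ {suc n} (fs i) x (inside ∷ A) = begin
  möbius x (inside ∷ A [ i ]≔ inside)
    ≡⟨ möbius-inside∷ x (A [ i ]≔ inside) ⟩
  möbius (∂ x) (A [ i ]≔ inside)
    ≡⟨ möbius-Δ i (∂ x) A ⟩
  möbius (Δ i (∂ x)) (A [ i ]≔ outside)
    ≡⟨ möbius-cong ∂-Δ-commute (A [ i ]≔ outside) ⟩
  möbius (∂ (Δ (fs i) x)) (A [ i ]≔ outside)
    ≡⟨ sym (möbius-inside∷ (Δ (fs i) x) (A [ i ]≔ outside)) ⟩
  möbius (Δ (fs i) x) (inside ∷ A [ i ]≔ outside) ∎
  where
  open ≡-Reasoning
  ∂ : (Subset (suc n) → ℤ₈) → Subset n → ℤ₈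
  ∂ y B = y (inside ∷ B) -₈ y (outside ∷ B)
  differences-commute : ∀ a b c d → (a -₈ b) -₈ (c -₈ d) ≡ (a -₈ c) -₈ (b -₈ d)
  differences-commute = solve-∀ ℤ₈-almostCommutativeRing
  ∂-Δ-commute : ∀ B → Δ i (∂ x) B ≡ ∂ (Δ (fs i) x) B
  ∂-Δ-commute B = differences-commute (x (inside ∷ B [ i ]≔ inside)) (x (outside ∷ B [ i ]≔ inside))
                                      (x (inside ∷ B [ i ]≔ outside)) (x (outside ∷ B [ i ]≔ outside))

möbius-Δ-inside≡0 : ∀ {n} i (x : Subset n → ℤ₈) A → möbius (Δ i x) (A [ i ]≔ inside) ≡ 0₈
möbius-Δ-inside≡0 i x A = trans (möbius-Δ i (Δ i x) A)
  (0∣x⇒x≈0 (möbius-preserves-∣ (λ B → x≡0⇒y∣x (Δ-Δ≡0 i x B)) (A [ i ]≔ outside)))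

Δ-∣⇒möbius-inside-∣ : ∀ {n m} i {x : Subset n → ℤ₈} →
  (∀ B → m ∣ Δ i x B) → ∀ A → m ∣ möbius x (A [ i ]≔ inside)
Δ-∣⇒möbius-inside-∣ {m = m} i {x} m∣Δx A =
  subst (m ∣_) (sym (möbius-Δ i x A)) (möbius-preserves-∣ m∣Δx (A [ i ]≔ outside))

infixl 6 _⊕_
infixl 7 _⊙_

_⊕_ _⊙_ : ∀ {n} → (Subset n → ℤ₈) → (Subset n → ℤ₈) → Subset n → ℤ₈
(x ⊕ y) B = x B +₈ y B
(x ⊙ y) B = x B *₈ y B

Δ-⊕ : ∀ {n} i (x y : Subset n → ℤ₈) B → Δ i (x ⊕ y) B ≡ Δ i x B +₈ Δ i y B
Δ-⊕ i x y B = interchange (x (B [ i ]≔ inside)) (y (B [ i ]≔ inside))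
                          (x (B [ i ]≔ outside)) (y (B [ i ]≔ outside))
  where
  interchange : ∀ a b c d → (a +₈ b) -₈ (c +₈ d) ≡ (a -₈ c) +₈ (b -₈ d)
  interchange = solve-∀ ℤ₈-almostCommutativeRing

leibniz : ∀ x₀ x₁ y₀ y₁ → x₁ *₈ y₁ -₈ x₀ *₈ y₀ ≡ (x₁ -₈ x₀) *₈ y₁ +₈ x₀ *₈ (y₁ -₈ y₀)
leibniz = solve-∀ ℤ₈-almostCommutativeRing

Δ-⊙ : ∀ {n} i (x y : Subset n → ℤ₈) B →
  Δ i (x ⊙ y) B ≡ Δ i x B *₈ y (B [ i ]≔ inside) +₈ x (B [ i ]≔ outside) *₈ Δ i y B
Δ-⊙ i x y B = leibniz (x (B [ i ]≔ outside)) (x (B [ i ]≔ inside))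
                      (y (B [ i ]≔ outside)) (y (B [ i ]≔ inside))

leibniz₂ : ∀ x₀₀ x₁₀ x₀₁ x₁₁ y₀₀ y₁₀ y₀₁ y₁₁ →
  (x₁₁ *₈ y₁₁ -₈ x₁₀ *₈ y₁₀) -₈ (x₀₁ *₈ y₀₁ -₈ x₀₀ *₈ y₀₀) ≡
  ((x₁₁ -₈ x₁₀) -₈ (x₀₁ -₈ x₀₀)) *₈ y₁₁ +₈ (x₀₁ -₈ x₀₀) *₈ (y₁₁ -₈ y₀₁)
    +₈ (x₁₀ -₈ x₀₀) *₈ (y₁₁ -₈ y₁₀) +₈ x₀₀ *₈ ((y₁₁ -₈ y₁₀) -₈ (y₀₁ -₈ y₀₀))
leibniz₂ = solve-∀ ℤ₈-almostCommutativeRing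

-- The filtration of ℤ₈^{P₄} by powers of 2

Δ₂ Δ₄ : Tuple → Tuple
Δ₂ = Δ e2
Δ₄ = Δ e4

Δ₂Δ₄-⊙ : ∀ x y B →
  Δ₂ (Δ₄ (x ⊙ y)) B ≡
  Δ₂ (Δ₄ x) B *₈ y (B [ e2 ]≔ inside [ e4 ]≔ inside)
    +₈ Δ₄ x (B [ e2 ]≔ outside) *₈ Δ₂ y (B [ e4 ]≔ inside)
    +₈ Δ₂ x (B [ e4 ]≔ outside) *₈ Δ₄ y (B [ e2 ]≔ inside)
    +₈ x (B [ e2 ]≔ outside [ e4 ]≔ outside) *₈ Δ₂ (Δ₄ y) B
Δ₂Δ₄-⊙ x y (a ∷ _ ∷ c ∷ _ ∷ []) =
  leibniz₂ (x′ outside outside) (x′ inside outside) (x′ outside inside) (x′ inside inside)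
           (y′ outside outside) (y′ inside outside) (y′ outside inside) (y′ inside inside)
  where
  x′ y′ : _ → _ → ℤ₈
  x′ s t = x (a ∷ s ∷ c ∷ t ∷ [])
  y′ s t = y (a ∷ s ∷ c ∷ t ∷ [])

^₈-+ : ∀ a k l → a ^₈ (k ℕ.+ l) ≡ a ^₈ k *₈ a ^₈ l
^₈-+ a zero    l = sym (*-identityˡ (a ^₈ l))
^₈-+ a (suc k) l = trans (cong (a *₈_) (^₈-+ a k l)) (sym (*-assoc a (a ^₈ k) (a ^₈ l)))

2^-∣-* : ∀ k l {a b} → 2₈ ^₈ k ∣ a → 2₈ ^₈ l ∣ b → 2₈ ^₈ (k ℕ.+ l) ∣ a *₈ b
2^-∣-* k l 2^k∣a 2^l∣b = subst (_∣ _) (sym (^₈-+ 2₈ k l)) (∙-cong-∣ 2^k∣a 2^l∣b)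

2^-∣-cast : ∀ {k m a} → k ≡ m → 2₈ ^₈ k ∣ a → 2₈ ^₈ m ∣ a
2^-∣-cast refl 2^k∣a = 2^k∣a

record Filtered (k : ℕ) (x : Tuple) : Set where
  field
    value      : ∀ B → 2₈ ^₈ k ∣ x B
    Δ₂-value   : ∀ B → 2₈ ^₈ suc k ∣ Δ₂ x B
    Δ₄-value   : ∀ B → 2₈ ^₈ suc k ∣ Δ₄ x B
    Δ₂Δ₄-value : ∀ B → 2₈ ^₈ suc (suc k) ∣ Δ₂ (Δ₄ x) B

open Filtered

Filtered-const : ∀ {k c} → 2₈ ^₈ k ∣ c → Filtered k (λ _ → c)
Filtered-const {c = c} 2^k∣c = record
  { value      = λ _ → 2^k∣c
  ; Δ₂-value   = λ _ → x≡0⇒y∣x (-‿inverseʳ c)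
  ; Δ₄-value   = λ _ → x≡0⇒y∣x (-‿inverseʳ c)
  ; Δ₂Δ₄-value = λ _ → x≡0⇒y∣x (-‿inverseʳ (c -₈ c))
  }

Filtered-⊕ : ∀ {k x y} → Filtered k x → Filtered k y → Filtered k (x ⊕ y)
Filtered-⊕ {x = x} {y} fx fy = record
  { value      = λ B → x∣y∧x∣z⇒x∣y+z (value fx B) (value fy B)
  ; Δ₂-value   = λ B → subst (_ ∣_) (sym (Δ-⊕ e2 x y B))
                                    (x∣y∧x∣z⇒x∣y+z (Δ₂-value fx B) (Δ₂-value fy B))
  ; Δ₄-value   = λ B → subst (_ ∣_) (sym (Δ-⊕ e4 x y B))
                                    (x∣y∧x∣z⇒x∣y+z (Δ₄-value fx B) (Δ₄-value fy B))
  ; Δ₂Δ₄-value = λ B → subst (_ ∣_) (sym (trans (Δ-cong e2 (Δ-⊕ e4 x y) B) (Δ-⊕ e2 (Δ₄ x) (Δ₄ y) B)))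
                                    (x∣y∧x∣z⇒x∣y+z (Δ₂Δ₄-value fx B) (Δ₂Δ₄-value fy B))
  }

Filtered-⊙ : ∀ {k l x y} → Filtered k x → Filtered l y → Filtered (k ℕ.+ l) (x ⊙ y)
Filtered-⊙ {k} {l} {x} {y} fx fy = record
  { value      = λ B → 2^-∣-* k l (value fx B) (value fy B)
  ; Δ₂-value   = first-order e2 (Δ₂-value fx) (Δ₂-value fy)
  ; Δ₄-value   = first-order e4 (Δ₄-value fx) (Δ₄-value fy)
  ; Δ₂Δ₄-value = second-order
  }
  where
  first-order : ∀ i → (∀ B → 2₈ ^₈ suc k ∣ Δ i x B) → (∀ B → 2₈ ^₈ suc l ∣ Δ i y B) →
                ∀ B → 2₈ ^₈ suc (k ℕ.+ l) ∣ Δ i (x ⊙ y) B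
  first-order i Δx Δy B = subst (_ ∣_) (sym (Δ-⊙ i x y B)) (x∣y∧x∣z⇒x∣y+z
    (2^-∣-* (suc k) l (Δx B) (value fy _))
    (2^-∣-cast (+-suc k l) (2^-∣-* k (suc l) (value fx _) (Δy B))))
  [1+k]+[1+l]≡2+[k+l] : suc k ℕ.+ suc l ≡ 2 ℕ.+ (k ℕ.+ l)
  [1+k]+[1+l]≡2+[k+l] = cong suc (+-suc k l)
  k+[2+l]≡2+[k+l] : k ℕ.+ (2 ℕ.+ l) ≡ 2 ℕ.+ (k ℕ.+ l)
  k+[2+l]≡2+[k+l] = trans (+-suc k (suc l)) (cong suc (+-suc k l))
  second-order : ∀ B → 2₈ ^₈ (2 ℕ.+ (k ℕ.+ l)) ∣ Δ₂ (Δ₄ (x ⊙ y)) B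
  second-order B = subst (_ ∣_) (sym (Δ₂Δ₄-⊙ x y B)) (x∣y∧x∣z⇒x∣y+z (x∣y∧x∣z⇒x∣y+z (x∣y∧x∣z⇒x∣y+z
    (2^-∣-* (2 ℕ.+ k) l (Δ₂Δ₄-value fx B) (value fy _))
    (2^-∣-cast [1+k]+[1+l]≡2+[k+l] (2^-∣-* (suc k) (suc l) (Δ₄-value fx _) (Δ₂-value fy _))))
    (2^-∣-cast [1+k]+[1+l]≡2+[k+l] (2^-∣-* (suc k) (suc l) (Δ₂-value fx _) (Δ₄-value fy _))))
    (2^-∣-cast k+[2+l]≡2+[k+l] (2^-∣-* k (2 ℕ.+ l) (value fx _) (Δ₂Δ₄-value fy B))))

-- Z between the levels 0 and 1

2∣⇒even : ∀ {a} → 2₈ ∣ a → Even₈ a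
2∣⇒even (q , refl) = toWitness {a? = all? λ q → 2 ∣ℕ? toℕ (q *₈ 2₈)} _ q

even⇒2∣ : ∀ {a} → Even₈ a → 2₈ ∣ a
even⇒2∣ {a} = toWitness {a? = all? λ a → (2 ∣ℕ? toℕ a) →-dec (2₈ ∣? a)} _ a

4∣⇒4∣ℕ : ∀ {a} → 2₈ ^₈ 2 ∣ a → 4 ∣ℕ toℕ a
4∣⇒4∣ℕ (q , refl) = toWitness {a? = all? λ q → 4 ∣ℕ? toℕ (q *₈ 2₈ ^₈ 2)} _ q

4∣ℕ⇒even : ∀ {a} → 4 ∣ℕ toℕ a → Even₈ a
4∣ℕ⇒even = ∣ℕ-trans (divides 2 refl)

≡[mod4]⇒even : ∀ {a b} → a ≡₈ 2₈ *₈ b [mod 4 ] → Even₈ a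
≡[mod4]⇒even {a} {b} = toWitness
  {a? = all? λ a → all? λ b → (toℕ a % 4 ≟ℕ toℕ (2₈ *₈ b) % 4) →-dec (2 ∣ℕ? toℕ a)} _ a b

4∣∧2∣⇒≡[mod4] : ∀ {a b} → 2₈ ^₈ 2 ∣ a → 2₈ ∣ b → a ≡₈ 2₈ *₈ b [mod 4 ]
4∣∧2∣⇒≡[mod4] (q , refl) (r , refl) = toWitness
  {a? = all? λ q → all? λ r → toℕ (q *₈ 2₈ ^₈ 2) % 4 ≟ℕ toℕ (2₈ *₈ (r *₈ 2₈)) % 4} _ q r

S24⊆ : ∀ {a c} → S24 ⊆ (a ∷ inside ∷ c ∷ inside ∷ [])
S24⊆ (there here)                 = there here
S24⊆ (there (there (there here))) = there (there (there here))

meets-S24 : ∀ A → Nonempty (A ∩ S24) → e2 ∈ˢ A ⊎ e4 ∈ˢ A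
meets-S24 A (_ , i∈A∩S24) with x∈p∩q⁻ A S24 i∈A∩S24
... | i∈A , there here                 = inj₁ i∈A
... | i∈A , there (there (there here)) = inj₂ i∈A

module _ {x : Tuple} (z : InZ x) where
  open InZ z

  private
    Z3-∋2 : ∀ a c d → ∣ a ∷ inside ∷ c ∷ d ∷ [] ∣ ≥ 2 → 2₈ ∣ coeff x (a ∷ inside ∷ c ∷ d ∷ [])
    Z3-∋2 a c d ∣A∣≥2 =
      even⇒2∣ (4∣ℕ⇒even (Z3 (a ∷ inside ∷ c ∷ d ∷ []) ∣A∣≥2 (e2 , there here)))
    Z3-∋4 : ∀ a b c → ∣ a ∷ b ∷ c ∷ inside ∷ [] ∣ ≥ 2 → 2₈ ∣ coeff x (a ∷ b ∷ c ∷ inside ∷ [])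
    Z3-∋4 a b c ∣A∣≥2 =
      even⇒2∣ (4∣ℕ⇒even (Z3 (a ∷ b ∷ c ∷ inside ∷ []) ∣A∣≥2 (e4 , there (there (there here)))))

  InZ⇒coeff-∋2-even : ∀ a c d → 2₈ ∣ coeff x (a ∷ inside ∷ c ∷ d ∷ [])
  InZ⇒coeff-∋2-even outside outside outside = even⇒2∣ (≡[mod4]⇒even {b = coeff x ⁅ e1 ⁆} Z1a)
  InZ⇒coeff-∋2-even inside  c       d       = Z3-∋2 inside  c       d       (s≤s (s≤s z≤n))
  InZ⇒coeff-∋2-even outside inside  d       = Z3-∋2 outside inside  d       (s≤s (s≤s z≤n))
  InZ⇒coeff-∋2-even outside outside inside  = Z3-∋2 outside outside inside  (s≤s (s≤s z≤n))

  InZ⇒coeff-∋4-even : ∀ a b c → 2₈ ∣ coeff x (a ∷ b ∷ c ∷ inside ∷ [])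
  InZ⇒coeff-∋4-even outside outside outside = even⇒2∣ (≡[mod4]⇒even {b = coeff x ⁅ e3 ⁆} Z1b)
  InZ⇒coeff-∋4-even outside outside inside  = Z3-∋4 outside outside inside  (s≤s (s≤s z≤n))
  InZ⇒coeff-∋4-even outside inside  outside = Z3-∋4 outside inside  outside (s≤s (s≤s z≤n))
  InZ⇒coeff-∋4-even outside inside  inside  = Z3-∋4 outside inside  inside  (s≤s (s≤s z≤n))
  InZ⇒coeff-∋4-even inside  outside outside = Z3-∋4 inside  outside outside (s≤s (s≤s z≤n))
  InZ⇒coeff-∋4-even inside  outside inside  = Z3-∋4 inside  outside inside  (s≤s (s≤s z≤n))
  InZ⇒coeff-∋4-even inside  inside  c       = Z3-∋4 inside  inside  c       (s≤s (s≤s z≤n))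

Z⇒Filtered₀ : ∀ {x} → InZ x → Filtered 0 x
Z⇒Filtered₀ {x} z = record
  { value      = λ B → ε∣ʳ x B
  ; Δ₂-value   = möbius-reflects-∣ (Δ₂ x) Δ₂-coeff
  ; Δ₄-value   = möbius-reflects-∣ (Δ₄ x) Δ₄-coeff
  ; Δ₂Δ₄-value = möbius-reflects-∣ (Δ₂ (Δ₄ x)) Δ₂Δ₄-coeff
  }
  where
  Δ₂-coeff : ∀ A → 2₈ ∣ möbius (Δ₂ x) A
  Δ₂-coeff A@(a ∷ outside ∷ c ∷ d ∷ []) = subst (_ ∣_) (möbius-Δ e2 x A) (InZ⇒coeff-∋2-even z a c d)
  Δ₂-coeff A@(_ ∷ inside  ∷ _ ∷ _ ∷ []) = x≡0⇒y∣x (möbius-Δ-inside≡0 e2 x A)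
  Δ₄-coeff : ∀ A → 2₈ ∣ möbius (Δ₄ x) A
  Δ₄-coeff A@(a ∷ b ∷ c ∷ outside ∷ []) = subst (_ ∣_) (möbius-Δ e4 x A) (InZ⇒coeff-∋4-even z a b c)
  Δ₄-coeff A@(_ ∷ _ ∷ _ ∷ inside  ∷ []) = x≡0⇒y∣x (möbius-Δ-inside≡0 e4 x A)
  Δ₂Δ₄-coeff : ∀ A → 2₈ ^₈ 2 ∣ möbius (Δ₂ (Δ₄ x)) A
  Δ₂Δ₄-coeff A@(_ ∷ inside  ∷ _ ∷ _       ∷ []) = x≡0⇒y∣x (möbius-Δ-inside≡0 e2 (Δ₄ x) A)
  Δ₂Δ₄-coeff A@(a ∷ outside ∷ c ∷ inside  ∷ []) = x≡0⇒y∣x (begin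
    möbius (Δ₂ (Δ₄ x)) A
      ≡⟨ sym (möbius-Δ e2 (Δ₄ x) A) ⟩
    möbius (Δ₄ x) (a ∷ inside ∷ c ∷ inside ∷ [])
      ≡⟨ möbius-Δ-inside≡0 e4 x (a ∷ inside ∷ c ∷ inside ∷ []) ⟩
    0₈ ∎)
    where open ≡-Reasoning
  Δ₂Δ₄-coeff A@(a ∷ outside ∷ c ∷ outside ∷ []) = x≡0⇒y∣x (begin
    möbius (Δ₂ (Δ₄ x)) A
      ≡⟨ sym (möbius-Δ e2 (Δ₄ x) A) ⟩
    möbius (Δ₄ x) (a ∷ inside ∷ c ∷ outside ∷ [])
      ≡⟨ sym (möbius-Δ e4 x (a ∷ inside ∷ c ∷ outside ∷ [])) ⟩
    coeff x (a ∷ inside ∷ c ∷ inside ∷ [])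
      ≡⟨ InZ.Z4 z (a ∷ inside ∷ c ∷ inside ∷ []) S24⊆ ⟩
    0₈ ∎)
    where open ≡-Reasoning

Filtered₁⇒Z : ∀ {x} → Filtered 1 x → InZ x
Filtered₁⇒Z {x} fx = record
  { Z1a = 4∣∧2∣⇒≡[mod4] (Δ-∣⇒möbius-inside-∣ e2 {x} (Δ₂-value fx) ∅) (coeff-even ⁅ e1 ⁆)
  ; Z1b = 4∣∧2∣⇒≡[mod4] (Δ-∣⇒möbius-inside-∣ e4 {x} (Δ₄-value fx) ∅) (coeff-even ⁅ e3 ⁆)
  ; Z2  = λ A _ → 2∣⇒even (coeff-even A)
  ; Z3  = Z3
  ; Z4  = Z4
  }
  where
  coeff-even : ∀ A → 2₈ ∣ coeff x A
  coeff-even = möbius-preserves-∣ (value fx)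
  Z3 : (A : P₄) → ∣ A ∣ ≥ 2 → Nonempty (A ∩ S24) → 4 ∣ℕ toℕ (coeff x A)
  Z3 A@(_ ∷ _ ∷ _ ∷ _ ∷ []) _ meets with meets-S24 A meets
  ... | inj₁ (there here)                 = 4∣⇒4∣ℕ (Δ-∣⇒möbius-inside-∣ e2 {x} (Δ₂-value fx) A)
  ... | inj₂ (there (there (there here))) = 4∣⇒4∣ℕ (Δ-∣⇒möbius-inside-∣ e4 {x} (Δ₄-value fx) A)
  Z4 : (A : P₄) → S24 ⊆ A → coeff x A ≡ 0₈
  Z4 (a ∷ _ ∷ c ∷ _ ∷ []) S24⊆A with S24⊆A (there here) | S24⊆A (there (there (there here)))
  ... | there here | there (there (there here)) = 0∣x⇒x≈0 (subst (_ ∣_)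
    (sym (trans (möbius-Δ e4 x (a ∷ inside ∷ c ∷ outside ∷ []))
                (möbius-Δ e2 (Δ₄ x) (a ∷ outside ∷ c ∷ outside ∷ []))))
    (möbius-preserves-∣ (Δ₂Δ₄-value fx) (a ∷ outside ∷ c ∷ outside ∷ [])))

-- The operation f

columns : ∀ {n} → Vec Tuple n → P₄ → Vec ℤ₈ n
columns ts A = Vec.map (λ t → t A) ts

^₈-Filtered₀ : ∀ {x} → Filtered 0 x → ∀ e → Filtered 0 (λ A → x A ^₈ e)
^₈-Filtered₀ fx zero    = Filtered-const (ε∣ʳ 1₈)
^₈-Filtered₀ fx (suc e) = Filtered-⊙ fx (^₈-Filtered₀ fx e)

prod₈-Filtered₀ : ∀ {n} {ts : Vec Tuple n} → All InZ ts → Filtered 0 (λ A → prod₈ (columns ts A))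
prod₈-Filtered₀ []       = Filtered-const (ε∣ʳ 1₈)
prod₈-Filtered₀ (z ∷ zs) = Filtered-⊙ (Z⇒Filtered₀ z) (prod₈-Filtered₀ zs)

monomial-Filtered₀ : ∀ {n} {ts : Vec Tuple n} → All InZ ts →
  ∀ α → Filtered 0 (λ A → monomial (columns ts A) α)
monomial-Filtered₀ []       []      = Filtered-const (ε∣ʳ 1₈)
monomial-Filtered₀ (z ∷ zs) (a ∷ α) =
  Filtered-⊙ (^₈-Filtered₀ (Z⇒Filtered₀ z) (toℕ a)) (monomial-Filtered₀ zs α)

sum₈-Filtered₁ : ∀ {n} {ts : Vec Tuple n} → All InZ ts → (b : Vec (Fin 3) n → ℤ₈) → ∀ αs →
  (∀ α → α ∈ αs → Even₈ (b α)) →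
  Filtered 1 (λ A → sum₈ (List.map (λ α → b α *₈ monomial (columns ts A) α) αs))
sum₈-Filtered₁ zs b []       _      = Filtered-const (2₈ ∣0)
sum₈-Filtered₁ zs b (α ∷ αs) b-even = Filtered-⊕
  (Filtered-⊙ (Filtered-const (even⇒2∣ (b-even α (here refl)))) (monomial-Filtered₀ zs α))
  (sum₈-Filtered₁ zs b αs (λ β β∈αs → b-even β (there β∈αs)))

lemma3p6 : (n : ℕ) → n ≥ 1 → (b : Vec (Fin 3) n → ℤ₈) →
    ((α : Vec (Fin 3) n) → α ∈ I n → Even₈ (b α)) →
    Preserves n (fOp n b)
lemma3p6 n _ b b-even ts ts∈Z =
  Filtered₁⇒Z (Filtered-⊙ (prod₈-Filtered₀ ts∈Z) (sum₈-Filtered₁ ts∈Z b (I n) b-even))
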